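{- Let $F$ and $g$ be positive integers. The following conditions are equivalent: (1) $g \leq F \leq 2g-1$; (2) $\mathcal{E}(F,g) \neq \emptyset$; (3) $\mathcal{S}(F,g) \neq \emptyset$.
   Context: A numerical semigroup is a subset $S \subseteq \mathbb{N}$ (with $\mathbb{N}$ the nonnegative integers) closed under addition, containing $0$, with $\mathbb{N}\setminus S$ finite. The genus $\mathrm{g}(S)$ is $\#(\mathbb{N}\setminus S)$; the Frobenius number $\mathrm{F}(S)$ is the largest integer not in $S$; the multiplicity $\mathrm{m}(S)$ is the least positive integer in $S$. $S$ is called elementary if $\mathrm{F}(S) < 2\,\mathrm{m}(S)$. $\mathcal{S}(F,g)$ denotes the set of numerical semigroups with Frobenius number $F$ and genus $g$, and $\mathcal{E}(F,g)$ the set of elementary numerical semigroups with Frobenius number $F$ and genus $g$. -}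

module Defs where

open import Data.Nat using (ℕ; zero; suc; _+_; _*_; _<_; _≤_)
open import Data.Bool using (Bool; true; false; not)
open import Data.List using (List; length; filter; upTo)
open import Data.Product using (Σ; ∃; _×_)
open import Relation.Binary.PropositionalEquality using (_≡_)
open import Relation.Nullary using (¬_)
open import Data.Bool.Properties using (T?)
open import Data.Bool using (T)

-- A subset of ℕ, given by its (Boolean) characteristic function.
-- (Every cofinite subset of ℕ is decidable, so this loses no generality.)
record NumericalSemigroup : Set where
  field
    mem      : ℕ → Bool
    zero∈    : mem 0 ≡ true
    closed   : ∀ a b → mem a ≡ true → mem b ≡ true → mem (a + b) ≡ true
    cofinite : ∃ λ c → ∀ n → c ≤ n → mem n ≡ true

open NumericalSemigroup public

_∈S_ : ℕ → NumericalSemigroup → Set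
n ∈S S = mem S n ≡ true

IsFrobenius : NumericalSemigroup → ℕ → Set
IsFrobenius S F = ¬ (F ∈S S) × (∀ n → F < n → n ∈S S)

IsMultiplicity : NumericalSemigroup → ℕ → Set
IsMultiplicity S m = (0 < m) × (m ∈S S) × (∀ k → 0 < k → k < m → ¬ (k ∈S S))

gapsBelow : NumericalSemigroup → ℕ → ℕ
gapsBelow S b = length (filter (λ n → T? (not (mem S n))) (upTo b))

-- g is the genus: #(ℕ ∖ S). Any c as in 'cofinite' bounds all gaps,
-- so the genus is the number of gaps below any such bound.
IsGenus : NumericalSemigroup → ℕ → Set
IsGenus S g = ∃ λ c → (∀ n → c ≤ n → n ∈S S) × gapsBelow S c ≡ g

InS : ℕ → ℕ → NumericalSemigroup → Set
InS F g S = IsFrobenius S F × IsGenus S g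

IsElementary : NumericalSemigroup → Set
IsElementary S = ∃ λ F → ∃ λ m → IsFrobenius S F × IsMultiplicity S m × F < 2 * m

InE : ℕ → ℕ → NumericalSemigroup → Set
InE F g S = InS F g S × IsElementary S

-- If F is the Frobenius number of S, then for x ≤ F at most one of x and F − x lies
-- in S, so x ↦ F − x maps the elements of S in [0, F] injectively to gaps. Hence among
-- the F + 1 integers of [0, F] at most half are elements and the g gaps are at least
-- half, giving F + 1 ≤ 2g; and 0 ∈ S gives g ≤ F. Conversely, for g ≤ F < 2g the set
-- {0} ∪ {n ≥ g : n ≠ F} is closed under addition (two nonzero elements sum to at
-- least 2g > F), has the g gaps 1, …, g − 1, F, and is elementary.
module Submission where

open import Defs
open import Data.Nat using (ℕ; _+_; _*_; _<_; _≤_)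
open import Data.Product using (_×_; ∃)
open import Function.Bundles using (_⇔_)

open import Data.Bool using (Bool; true; false; not)
open import Data.Bool.Properties using (T?)
open import Data.Empty using (⊥-elim)
open import Data.List using (length; filter; applyUpTo)
open import Data.Nat using (zero; suc; _∸_; z≤n; s≤s; _≤?_; _≟_)
open import Data.Nat.Properties
open import Data.Product using (_,_; proj₁; proj₂)
open import Data.Sum using (_⊎_; inj₁; inj₂)
open import Function using (_∘_)
open import Function.Bundles using (mk⇔)
open import Relation.Binary.PropositionalEquality
open import Relation.Nullary using (¬_; yes; no)

sumBelow : (ℕ → ℕ) → ℕ → ℕ
sumBelow h zero    = 0
sumBelow h (suc n) = sumBelow h n + h n

sumBelow-suc-head : ∀ h n → sumBelow h (suc n) ≡ h 0 + sumBelow (h ∘ suc) n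
sumBelow-suc-head h zero    = +-comm 0 (h 0)
sumBelow-suc-head h (suc n) rewrite sumBelow-suc-head h n = +-assoc (h 0) _ (h (suc n))

sumBelow-reflect : ∀ h n → sumBelow h (suc n) ≡ sumBelow (λ x → h (n ∸ x)) (suc n)
sumBelow-reflect h zero    = refl
sumBelow-reflect h (suc n) = begin
  sumBelow h (suc n) + h (suc n)                    ≡⟨ +-comm _ (h (suc n)) ⟩
  h (suc n) + sumBelow h (suc n)                    ≡⟨ cong (h (suc n) +_) (sumBelow-reflect h n) ⟩
  h (suc n) + sumBelow (λ x → h (n ∸ x)) (suc n)    ≡⟨ sumBelow-suc-head (λ x → h (suc n ∸ x)) (suc n) ⟨
  sumBelow (λ x → h (suc n ∸ x)) (suc (suc n))      ∎
  where open ≡-Reasoning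

sumBelow-cong : ∀ {f g} n → (∀ x → f x ≡ g x) → sumBelow f n ≡ sumBelow g n
sumBelow-cong zero    f≗g = refl
sumBelow-cong (suc n) f≗g = cong₂ _+_ (sumBelow-cong n f≗g) (f≗g n)

sumBelow-+ : ∀ f g n → sumBelow (λ x → f x + g x) n ≡ sumBelow f n + sumBelow g n
sumBelow-+ f g zero    = refl
sumBelow-+ f g (suc n) rewrite sumBelow-+ f g n =
  +-assoc-comm-middle (sumBelow f n) (sumBelow g n) (f n) (g n)
  where
  +-assoc-comm-middle : ∀ a b c d → (a + b) + (c + d) ≡ (a + c) + (b + d)
  +-assoc-comm-middle a b c d = begin
    (a + b) + (c + d) ≡⟨ +-assoc a b (c + d) ⟩
    a + (b + (c + d)) ≡⟨ cong (a +_) (+-assoc b c d) ⟨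
    a + ((b + c) + d) ≡⟨ cong (λ z → a + (z + d)) (+-comm b c) ⟩
    a + ((c + b) + d) ≡⟨ cong (a +_) (+-assoc c b d) ⟩
    a + (c + (b + d)) ≡⟨ +-assoc a c (b + d) ⟨
    (a + c) + (b + d) ∎
    where open ≡-Reasoning

sumBelow-one : ∀ n → sumBelow (λ _ → 1) n ≡ n
sumBelow-one zero    = refl
sumBelow-one (suc n) rewrite sumBelow-one n = +-comm n 1

sumBelow-mono-≤ : ∀ {f g} n → (∀ x → x < n → f x ≤ g x) → sumBelow f n ≤ sumBelow g n
sumBelow-mono-≤ zero    f≤g = z≤n
sumBelow-mono-≤ (suc n) f≤g =
  +-mono-≤ (sumBelow-mono-≤ n (λ x x<n → f≤g x (m<n⇒m<1+n x<n))) (f≤g n ≤-refl)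

sumBelow-≤-length : ∀ {h} n → (∀ x → x < n → h x ≤ 1) → sumBelow h n ≤ n
sumBelow-≤-length {h} n h≤1 = subst (sumBelow h n ≤_) (sumBelow-one n) (sumBelow-mono-≤ n h≤1)

sumBelow-vanishing : ∀ h {a b} → a ≤ b → (∀ x → a ≤ x → x < b → h x ≡ 0) →
                     sumBelow h b ≡ sumBelow h a
sumBelow-vanishing h {b = zero}  z≤n  vanish = refl
sumBelow-vanishing h {b = suc b} a≤1+b vanish with m≤n⇒m<n∨m≡n a≤1+b
... | inj₂ refl = refl
... | inj₁ a≤b
  rewrite vanish b (≤-pred a≤b) ≤-refl
        | sumBelow-vanishing h (≤-pred a≤b)
            (λ x a≤x x<b → vanish x a≤x (m<n⇒m<1+n x<b)) = +-identityʳ _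

gapIndicator : Bool → ℕ
gapIndicator true  = 0
gapIndicator false = 1

memberIndicator : Bool → ℕ
memberIndicator true  = 1
memberIndicator false = 0

gapIndicator≤1 : ∀ b → gapIndicator b ≤ 1
gapIndicator≤1 true  = z≤n
gapIndicator≤1 false = s≤s z≤n

gapIndicator+memberIndicator : ∀ b → gapIndicator b + memberIndicator b ≡ 1
gapIndicator+memberIndicator true  = refl
gapIndicator+memberIndicator false = refl

length-filter-not : ∀ (p : ℕ → Bool) f n →
  length (filter (λ k → T? (not (p k))) (applyUpTo f n)) ≡ sumBelow (gapIndicator ∘ p ∘ f) n
length-filter-not p f zero = refl
length-filter-not p f (suc n)
  rewrite sumBelow-suc-head (gapIndicator ∘ p ∘ f) n with p (f 0)
... | true  = length-filter-not p (f ∘ suc) n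
... | false = cong suc (length-filter-not p (f ∘ suc) n)

module Counting (S : NumericalSemigroup) where

  gaps : ℕ → ℕ
  gaps = sumBelow (gapIndicator ∘ mem S)

  members : ℕ → ℕ
  members = sumBelow (memberIndicator ∘ mem S)

  gaps+members : ∀ n → gaps n + members n ≡ n
  gaps+members n = begin
    gaps n + members n                                        ≡⟨ sumBelow-+ _ _ n ⟨
    sumBelow (λ x → gapIndicator (mem S x) + memberIndicator (mem S x)) n
                                                              ≡⟨ sumBelow-cong n (gapIndicator+memberIndicator ∘ mem S) ⟩
    sumBelow (λ _ → 1) n                                      ≡⟨ sumBelow-one n ⟩
    n                                                         ∎
    where open ≡-Reasoning

  gaps-suc≤ : ∀ n → gaps (suc n) ≤ n
  gaps-suc≤ n rewrite sumBelow-suc-head (gapIndicator ∘ mem S) n | zero∈ S =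
    sumBelow-≤-length n (λ x _ → gapIndicator≤1 (mem S (suc x)))

  module _ {F : ℕ} (frob : IsFrobenius S F) where

    private
      F∉S : ¬ (F ∈S S)
      F∉S = proj₁ frob

    Frobenius<bound : ∀ {c} → (∀ n → c ≤ n → n ∈S S) → F < c
    Frobenius<bound {c} cofin with c ≤? F
    ... | yes c≤F = ⊥-elim (F∉S (cofin F c≤F))
    ... | no  c≰F = ≰⇒> c≰F

    gaps-suc-Frobenius : ∀ {g} → IsGenus S g → gaps (suc F) ≡ g
    gaps-suc-Frobenius {g} (c , cofin , gapsBelow≡g) = begin
      gaps (suc F)  ≡⟨ sumBelow-vanishing _ (Frobenius<bound cofin)
                         (λ x F<x _ → cong gapIndicator (proj₂ frob x F<x)) ⟨
      gaps c        ≡⟨ length-filter-not (mem S) (λ k → k) c ⟨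
      gapsBelow S c ≡⟨ gapsBelow≡g ⟩
      g             ∎
      where open ≡-Reasoning

    -- x and F − x cannot both lie in S, since their sum F does not.
    members-reflect : ∀ x → x ≤ F →
      memberIndicator (mem S x) + memberIndicator (mem S (F ∸ x)) ≤ 1
    members-reflect x x≤F with mem S x in x∈S | mem S (F ∸ x) in F∸x∈S
    ... | true  | true  =
      ⊥-elim (F∉S (subst (_∈S S) (m+[n∸m]≡n x≤F) (closed S x (F ∸ x) x∈S F∸x∈S)))
    ... | true  | false = ≤-refl
    ... | false | true  = ≤-refl
    ... | false | false = z≤n

    members≤gaps : members (suc F) ≤ gaps (suc F)
    members≤gaps = +-cancelʳ-≤ M _ _ (begin
      M + M                                            ≡⟨ cong (M +_) (sumBelow-reflect _ F) ⟩
      M + sumBelow (memberIndicator ∘ mem S ∘ (F ∸_)) (suc F)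
                                                       ≡⟨ sumBelow-+ _ _ (suc F) ⟨
      sumBelow (λ x → memberIndicator (mem S x) + memberIndicator (mem S (F ∸ x))) (suc F)
                                                       ≤⟨ sumBelow-≤-length (suc F) (λ x x<1+F → members-reflect x (≤-pred x<1+F)) ⟩
      suc F                                            ≡⟨ gaps+members (suc F) ⟨
      gaps (suc F) + M                                 ∎)
      where
      open ≤-Reasoning
      M : ℕ
      M = members (suc F)

InS⇒bounds : ∀ {F g} → (∃ λ S → InS F g S) → g ≤ F × F + 1 ≤ 2 * g
InS⇒bounds {F} {g} (S , frob , genus) = g≤F , F+1≤2g
  where
  open Counting S
  G≡g : gaps (suc F) ≡ g
  G≡g = gaps-suc-Frobenius frob genus

  g≤F : g ≤ F
  g≤F = subst (_≤ F) G≡g (gaps-suc≤ F)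

  F+1≤2g : F + 1 ≤ 2 * g
  F+1≤2g = begin
    F + 1                            ≡⟨ +-comm F 1 ⟩
    suc F                            ≡⟨ gaps+members (suc F) ⟨
    gaps (suc F) + members (suc F)   ≤⟨ +-monoʳ-≤ (gaps (suc F)) (members≤gaps frob) ⟩
    gaps (suc F) + gaps (suc F)      ≡⟨ cong₂ _+_ G≡g (trans G≡g (sym (+-identityʳ g))) ⟩
    2 * g                            ∎
    where open ≤-Reasoning

module WithHoleAtFrobenius (g F : ℕ) (0<g : 0 < g) (g≤F : g ≤ F) (F<2g : F < g + g) where

  member? : ℕ → Bool
  member? zero = true
  member? (suc n) with g ≤? suc n | suc n ≟ F
  ... | yes _ | no _  = true
  ... | yes _ | yes _ = false
  ... | no _  | _     = false

  member-intro : ∀ n → g ≤ n → n ≢ F → member? n ≡ true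
  member-intro zero    g≤n n≢F = refl
  member-intro (suc n) g≤n n≢F with g ≤? suc n | suc n ≟ F
  ... | yes _   | no _     = refl
  ... | yes _   | yes n≡F  = ⊥-elim (n≢F n≡F)
  ... | no  g≰n | _        = ⊥-elim (g≰n g≤n)

  member-elim : ∀ n → member? n ≡ true → n ≡ 0 ⊎ (g ≤ n × n ≢ F)
  member-elim zero    _ = inj₁ refl
  member-elim (suc n) n∈S with g ≤? suc n | suc n ≟ F
  member-elim (suc n) n∈S | yes g≤n | no n≢F = inj₂ (g≤n , n≢F)
  member-elim (suc n) ()  | yes _   | yes _
  member-elim (suc n) ()  | no _    | _

  positive-member-≥ : ∀ n → 0 < n → member? n ≡ true → g ≤ n
  positive-member-≥ n 0<n n∈S with member-elim n n∈S
  ... | inj₁ n≡0        = ⊥-elim (<⇒≢ 0<n (sym n≡0))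
  ... | inj₂ (g≤n , _)  = g≤n

  member?-closed : ∀ a b → member? a ≡ true → member? b ≡ true → member? (a + b) ≡ true
  member?-closed zero b _ b∈S = b∈S
  member?-closed a@(suc _) zero a∈S _ = subst (λ z → member? z ≡ true) (sym (+-identityʳ a)) a∈S
  member?-closed a@(suc _) b@(suc _) a∈S b∈S =
    member-intro (a + b) (≤-trans g≤a (m≤m+n a b))
      (λ a+b≡F → <⇒≢ (<-≤-trans F<2g (+-mono-≤ g≤a g≤b)) (sym a+b≡F))
    where
    g≤a = positive-member-≥ a (s≤s z≤n) a∈S
    g≤b = positive-member-≥ b (s≤s z≤n) b∈S

  F∉S : member? F ≢ true
  F∉S F∈S with member-elim F F∈S
  ... | inj₁ F≡0       = <⇒≢ (<-≤-trans 0<g g≤F) (sym F≡0)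
  ... | inj₂ (_ , F≢F) = F≢F refl

  above-F : ∀ n → F < n → member? n ≡ true
  above-F n F<n = member-intro n (≤-trans g≤F (<⇒≤ F<n)) (λ n≡F → <⇒≢ F<n (sym n≡F))

  S : NumericalSemigroup
  S = record
    { mem      = member?
    ; zero∈    = refl
    ; closed   = member?-closed
    ; cofinite = suc F , above-F
    }

  frobenius : IsFrobenius S F
  frobenius = F∉S , above-F

  open Counting S using (gaps)

  gaps-initial : ∀ j → j ≤ g → gaps j ≡ j ∸ 1
  gaps-initial zero          _   = refl
  gaps-initial (suc zero)    _   = refl
  gaps-initial (suc (suc j)) j<g
    rewrite gaps-initial (suc j) (<⇒≤ j<g) with member? (suc j) in j∈S
  ... | false = +-comm j 1
  ... | true  = ⊥-elim (<⇒≱ j<g (positive-member-≥ (suc j) (s≤s z≤n) j∈S))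

  genus : IsGenus S g
  genus = suc F , above-F , (begin
    gapsBelow S (suc F)                  ≡⟨ length-filter-not member? (λ k → k) (suc F) ⟩
    gaps F + gapIndicator (member? F)    ≡⟨ cong₂ _+_ gaps-F (gapIndicator-F (member? F) F∉S) ⟩
    g ∸ 1 + 1                            ≡⟨ m∸n+n≡m 0<g ⟩
    g                                    ∎)
    where
    open ≡-Reasoning
    gapIndicator-F : ∀ b → b ≢ true → gapIndicator b ≡ 1
    gapIndicator-F true  b≢true = ⊥-elim (b≢true refl)
    gapIndicator-F false _      = refl
    gaps-F : gaps F ≡ g ∸ 1
    gaps-F = begin
      gaps F ≡⟨ sumBelow-vanishing _ g≤F (λ x g≤x x<F →
                  cong gapIndicator (member-intro x g≤x (<⇒≢ x<F))) ⟩
      gaps g ≡⟨ gaps-initial g ≤-refl ⟩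
      g ∸ 1  ∎

  multiplicity : ∀ m → 0 < m → member? m ≡ true → (∀ k → g ≤ k → k < m → k ≡ F) →
                 IsMultiplicity S m
  multiplicity m 0<m m∈S only-F = 0<m , m∈S , λ k 0<k k<m k∈S →
    F∉S (subst (λ z → member? z ≡ true)
               (only-F k (positive-member-≥ k 0<k k∈S) k<m) k∈S)

  elementary : IsElementary S
  elementary with m≤n⇒m<n∨m≡n g≤F
  ... | inj₁ g<F = F , g , frobenius ,
        multiplicity g 0<g (member-intro g ≤-refl (<⇒≢ g<F)) (λ k g≤k k<g → ⊥-elim (<⇒≱ k<g g≤k)) ,
        subst (F <_) (cong (g +_) (sym (+-identityʳ g))) F<2g
  ... | inj₂ g≡F = F , suc F , frobenius ,
        multiplicity (suc F) (s≤s z≤n) (above-F (suc F) ≤-refl)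
          (λ k g≤k k<1+F → ≤-antisym (≤-pred k<1+F) (subst (_≤ k) g≡F g≤k)) ,
        m≤m+n (suc F) (suc F + 0)

  inE : InE F g S
  inE = (frobenius , genus) , elementary

bounds⇒InE : ∀ {F g} → 0 < g → g ≤ F × F + 1 ≤ 2 * g → ∃ λ S → InE F g S
bounds⇒InE {F} {g} 0<g (g≤F , F+1≤2g) = S , inE
  where
  F<2g : F < g + g
  F<2g = subst₂ _≤_ (+-comm F 1) (cong (g +_) (+-identityʳ g)) F+1≤2g
  open WithHoleAtFrobenius g F 0<g g≤F F<2g

proposition2 : (F g : ℕ) → 0 < F → 0 < g →
    ((g ≤ F × F + 1 ≤ 2 * g) ⇔ (∃ λ S → InE F g S))
    × ((∃ λ S → InE F g S) ⇔ (∃ λ S → InS F g S))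
-- The hypothesis 0 < F is redundant: it follows from 0 < g ≤ F.
proposition2 F g _ 0<g =
  mk⇔ (bounds⇒InE 0<g) (InS⇒bounds ∘ InE⇒InS) ,
  mk⇔ InE⇒InS (bounds⇒InE 0<g ∘ InS⇒bounds)
  where
  InE⇒InS : (∃ λ S → InE F g S) → ∃ λ S → InS F g S
  InE⇒InS (S , inS , _) = S , inS
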